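{- Work in classical second-order logic (with the full Comprehension scheme) whose only non-logical primitive is the binary relation $\in$, and assume only the axioms Extensionality and Separation. Then the levels are well-ordered by membership, in the following sense: (i) for every second-order property $F$, if some level has $F$, then there is a level $s$ with $F(s)$ such that no level $r$ with $F(r)$ satisfies $r\in s$; and (ii) any two levels $s,t$ are comparable: $s\in t\lor s=t\lor t\in s$.
   Context: All objects are sets. Extensionality: $\forall a\forall b(\forall x(x\in a\leftrightarrow x\in b)\to a=b)$. Separation: $\forall F\forall a\exists b\forall x(x\in b\leftrightarrow(F(x)\land x\in a))$. For a set $a$, its potentiation $\mathrm{pot}(a)$ is the set $\{x:\exists c(x\subseteq c\land c\in a)\}$, when it exists ("$b=\mathrm{pot}(a)$" abbreviates $\forall x(x\in b\leftrightarrow\exists c(x\subseteq c\land c\in a))$). A set $h$ is a history iff for every $x\in h$, $x=\mathrm{pot}(x\cap h)$. A set $s$ is a level iff $s=\mathrm{pot}(h)$ for some history $h$. -}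

module Defs where

open import Data.Product using (Σ; _×_; _,_; ∃; ∃-syntax)
open import Data.Sum using (_⊎_)
open import Relation.Nullary using (¬_)
open import Relation.Binary.PropositionalEquality using (_≡_)

_↔_ : Set → Set → Set
A ↔ B = (A → B) × (B → A)

LEM : Set₁
LEM = (P : Set) → P ⊎ ¬ P

module _ (V : Set) (_∈_ : V → V → Set) where

  Extensionality : Set
  Extensionality = ∀ a b → (∀ x → (x ∈ a) ↔ (x ∈ b)) → a ≡ b

  -- Separation for every second-order property F (full comprehension: F : V → Set).
  Separation : Set₁
  Separation = (F : V → Set) → ∀ a → ∃[ b ] (∀ x → (x ∈ b) ↔ (F x × x ∈ a))

  _⊆_ : V → V → Set
  x ⊆ c = ∀ y → y ∈ x → y ∈ c

  IsPot : V → V → Set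
  IsPot b a = ∀ x → (x ∈ b) ↔ (∃[ c ] (x ⊆ c × c ∈ a))

  IsInter : V → V → V → Set
  IsInter i x h = ∀ z → (z ∈ i) ↔ (z ∈ x × z ∈ h)

  IsHistory : V → Set
  IsHistory h = ∀ x → x ∈ h → ∃[ i ] (IsInter i x h × IsPot x i)

  IsLevel : V → Set
  IsLevel s = ∃[ h ] (IsHistory h × IsPot s h)

{-# OPTIONS --safe #-}
-- Write x ≺ y when every subset of x is an element of y. Every element of a
-- set of the form pot(a) is ≺ that set, and ≺ admits no descending predicate:
-- otherwise the Russell set W = {z ∈ x : z lies in every set satisfying the
-- predicate, z ∉ z} would be a subset, hence an element, of each such set, so
-- W ∈ W ↔ W ∉ W. Classically this makes ≺ well-founded, and since s ∈ t
-- implies s ≺ t for levels, ∈ is well-founded on levels. Comparability of two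
-- levels s = pot(h), t = pot(k) then follows by a double ≺-induction: if
-- neither s ∈ t nor t ∈ s, comparing each c ∈ h with t (and each c ∈ k with s)
-- shows s ⊆ t and t ⊆ s, so s = t by Extensionality.
module Submission where

open import Defs
open import Data.Product using (_×_; _,_; ∃; ∃-syntax; proj₁; proj₂)
open import Data.Sum using (_⊎_; inj₁; inj₂)
open import Data.Empty using (⊥-elim)
open import Relation.Nullary using (¬_)
open import Relation.Binary.PropositionalEquality using (_≡_; refl)

module _ (V : Set) (_∈_ : V → V → Set) where

  private
    _⊆′_ : V → V → Set
    _⊆′_ = _⊆_ V _∈_

    Level : V → Set
    Level = IsLevel V _∈_

    History : V → Set
    History = IsHistory V _∈_

  _≺_ : V → V → Set
  x ≺ y = ∀ c → c ⊆′ x → c ∈ y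

  Comparable : V → V → Set
  Comparable s t = (s ∈ t) ⊎ (s ≡ t) ⊎ (t ∈ s)

  Comparable-sym : ∀ {s t} → Comparable s t → Comparable t s
  Comparable-sym (inj₁ s∈t)         = inj₂ (inj₂ s∈t)
  Comparable-sym (inj₂ (inj₁ refl)) = inj₂ (inj₁ refl)
  Comparable-sym (inj₂ (inj₂ t∈s))  = inj₁ t∈s

  ∈pot⇒≺ : ∀ {b a x} → IsPot V _∈_ b a → x ∈ b → x ≺ b
  ∈pot⇒≺ {x = x} b≡pot[a] x∈b c c⊆x with proj₁ (b≡pot[a] x) x∈b
  ... | d , x⊆d , d∈a = proj₂ (b≡pot[a] c) (d , (λ z z∈c → x⊆d z (c⊆x z z∈c)) , d∈a)

  ∈⇒∈pot : ∀ {b a c} → IsPot V _∈_ b a → c ∈ a → c ∈ b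
  ∈⇒∈pot {c = c} b≡pot[a] c∈a = proj₂ (b≡pot[a] c) (c , (λ z z∈c → z∈c) , c∈a)

  level-transitive : ∀ {s r} → Level s → r ∈ s → r ⊆′ s
  level-transitive {r = r} (h , history , s≡pot[h]) r∈s z z∈r
    with proj₁ (s≡pot[h] r) r∈s
  ... | c , r⊆c , c∈h with history c c∈h
  ... | i , i≡c∩h , c≡pot[i] with proj₁ (c≡pot[i] z) (r⊆c z z∈r)
  ... | d , z⊆d , d∈i = proj₂ (s≡pot[h] z) (d , z⊆d , proj₂ (proj₁ (i≡c∩h d) d∈i))

  ∩-restrict : ∀ {j y i x h} → IsInter V _∈_ j y h → IsInter V _∈_ i x h → y ⊆′ x
             → IsInter V _∈_ j y i
  ∩-restrict j≡y∩h i≡x∩h y⊆x z =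
      (λ z∈j → let (z∈y , z∈h) = proj₁ (j≡y∩h z) z∈j
               in z∈y , proj₂ (i≡x∩h z) (y⊆x z z∈y , z∈h))
    , (λ { (z∈y , z∈i) → proj₂ (j≡y∩h z) (z∈y , proj₂ (proj₁ (i≡x∩h z) z∈i)) })

  -- t is compared only with the generators c ∈ h of s, each of which is ≺ s,
  -- so that the induction hypothesis applies.
  pot-⊆-level : ∀ {s h t} → History h → IsPot V _∈_ s h → Level t → ¬ (t ∈ s)
              → (∀ c → c ∈ h → Comparable c t) → s ⊆′ t
  pot-⊆-level {s} {h} {t} history s≡pot[h] (_ , _ , t≡pot[k]) t∉s compare x x∈s
    with proj₁ (s≡pot[h] x) x∈s
  ... | c , x⊆c , c∈h with compare c c∈h
  ... | inj₁ c∈t         = ∈pot⇒≺ t≡pot[k] c∈t x x⊆c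
  ... | inj₂ (inj₁ refl) = ⊥-elim (t∉s (∈⇒∈pot s≡pot[h] c∈h))
  ... | inj₂ (inj₂ t∈c)  =
    ⊥-elim (t∉s (level-transitive (h , history , s≡pot[h]) (∈⇒∈pot s≡pot[h] c∈h) t t∈c))

  module _ (sep : Separation V _∈_) where

    no-≺-descent : (P : V → Set) → (∀ y → P y → ∃[ y′ ] (P y′ × y′ ≺ y)) → ∀ x → ¬ P x
    no-≺-descent P descend x Px = W∉W (W∈W-if W∉W)
      where
      InAllAndNotSelf : V → Set
      InAllAndNotSelf z = (∀ y → P y → z ∈ y) × ¬ (z ∈ z)

      W : V
      W = proj₁ (sep InAllAndNotSelf x)

      W-spec : ∀ z → (z ∈ W) ↔ (InAllAndNotSelf z × z ∈ x)
      W-spec = proj₂ (sep InAllAndNotSelf x)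

      W∈all : ∀ y → P y → W ∈ y
      W∈all y Py with descend y Py
      ... | y′ , Py′ , y′≺y = y′≺y W (λ z z∈W → proj₁ (proj₁ (proj₁ (W-spec z) z∈W)) y′ Py′)

      W∉W : ¬ (W ∈ W)
      W∉W W∈W = proj₂ (proj₁ (proj₁ (W-spec W) W∈W)) W∈W

      W∈W-if : ¬ (W ∈ W) → W ∈ W
      W∈W-if W∉W′ = proj₂ (W-spec W) ((W∈all , W∉W′) , W∈all x Px)

    module _ (lem : LEM) where

      ≺-minimal : (P : V → Set) → ∀ x → P x → ∃[ y ] (P y × (∀ y′ → y′ ≺ y → ¬ P y′))
      ≺-minimal P x Px with lem (∃[ y ] (P y × (∀ y′ → y′ ≺ y → ¬ P y′)))
      ... | inj₁ minimal  = minimal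
      ... | inj₂ ¬minimal = ⊥-elim (no-≺-descent P descend x Px)
        where
        descend : ∀ y → P y → ∃[ y′ ] (P y′ × y′ ≺ y)
        descend y Py with lem (∃[ y′ ] (P y′ × y′ ≺ y))
        ... | inj₁ below  = below
        ... | inj₂ ¬below = ⊥-elim (¬minimal (y , Py , λ y′ y′≺y Py′ → ¬below (y′ , Py′ , y′≺y)))

      ≺-ind : (Q : V → Set) → (∀ y → (∀ y′ → y′ ≺ y → Q y′) → Q y) → ∀ x → Q x
      ≺-ind Q step x with lem (Q x)
      ... | inj₁ Qx  = Qx
      ... | inj₂ ¬Qx with ≺-minimal (λ y → ¬ Q y) x ¬Qx
      ... | y , ¬Qy , minimal = ⊥-elim (¬Qy (step y λ y′ y′≺y → stable y′ (minimal y′ y′≺y)))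
        where
        stable : ∀ z → ¬ ¬ Q z → Q z
        stable z ¬¬Qz with lem (Q z)
        ... | inj₁ Qz  = Qz
        ... | inj₂ ¬Qz = ⊥-elim (¬¬Qz ¬Qz)

      history-∈⇒⊆ : ∀ {h} → History h → ∀ x → x ∈ h → ∀ y → y ∈ x → y ∈ h → y ⊆′ x
      history-∈⇒⊆ {h} history = ≺-ind Q step
        where
        Q : V → Set
        Q x = x ∈ h → ∀ y → y ∈ x → y ∈ h → y ⊆′ x

        step : ∀ x → (∀ x′ → x′ ≺ x → Q x′) → Q x
        step x ih x∈h y y∈x y∈h z z∈y with history x x∈h | history y y∈h
        ... | i , i≡x∩h , x≡pot[i] | j , j≡y∩h , y≡pot[j] with proj₁ (y≡pot[j] z) z∈y
        ... | d , z⊆d , d∈j = proj₂ (x≡pot[i] z) (y , z⊆y , proj₂ (i≡x∩h y) (y∈x , y∈h))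
          where
          d⊆y : d ⊆′ y
          d⊆y = let (d∈y , d∈h) = proj₁ (j≡y∩h d) d∈j
                in ih y (∈pot⇒≺ x≡pot[i] y∈x) y∈h d d∈y d∈h

          z⊆y : z ⊆′ y
          z⊆y w w∈z = d⊆y w (z⊆d w w∈z)

      history-∈⇒level : ∀ {h} → History h → ∀ x → x ∈ h → Level x
      history-∈⇒level history x x∈h with history x x∈h
      ... | i , i≡x∩h , x≡pot[i] = i , i-history , x≡pot[i]
        where
        i-history : History i
        i-history y y∈i with proj₁ (i≡x∩h y) y∈i
        ... | y∈x , y∈h with history y y∈h
        ... | j , j≡y∩h , y≡pot[j] =
          j , ∩-restrict j≡y∩h i≡x∩h (history-∈⇒⊆ history x x∈h y y∈x y∈h) , y≡pot[j]

      level-∈-minimal : (F : V → Set) → ∃[ s ] (Level s × F s)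
                      → ∃[ s ] (Level s × F s × (∀ r → Level r → F r → ¬ (r ∈ s)))
      level-∈-minimal F (s₀ , Ls₀ , Fs₀) with ≺-minimal (λ s → Level s × F s) s₀ (Ls₀ , Fs₀)
      ... | s , (Ls@(_ , _ , s≡pot[h]) , Fs) , minimal =
        s , Ls , Fs , λ r Lr Fr r∈s → minimal r (∈pot⇒≺ s≡pot[h] r∈s) (Lr , Fr)

      module _ (ext : Extensionality V _∈_) where

        levels-comparable : ∀ s t → Level s → Level t → Comparable s t
        levels-comparable = ≺-ind (λ s → ∀ t → Level s → Level t → Comparable s t) outer
          where
          outer : ∀ s → (∀ s′ → s′ ≺ s → ∀ t → Level s′ → Level t → Comparable s′ t)
                → ∀ t → Level s → Level t → Comparable s t
          outer s ih-s = ≺-ind (λ t → Level s → Level t → Comparable s t) inner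
            where
            inner : ∀ t → (∀ t′ → t′ ≺ t → Level s → Level t′ → Comparable s t′)
                  → Level s → Level t → Comparable s t
            inner t ih-t Ls@(_ , h-history , s≡pot[h]) Lt@(_ , k-history , t≡pot[k])
              with lem (s ∈ t) | lem (t ∈ s)
            ... | inj₁ s∈t | _        = inj₁ s∈t
            ... | inj₂ _   | inj₁ t∈s = inj₂ (inj₂ t∈s)
            ... | inj₂ s∉t | inj₂ t∉s =
              inj₂ (inj₁ (ext s t λ x → s⊆t x , t⊆s x))
              where
              s⊆t : s ⊆′ t
              s⊆t = pot-⊆-level h-history s≡pot[h] Lt t∉s λ c c∈h →
                ih-s c (∈pot⇒≺ s≡pot[h] (∈⇒∈pot s≡pot[h] c∈h)) t
                     (history-∈⇒level h-history c c∈h) Lt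

              t⊆s : t ⊆′ s
              t⊆s = pot-⊆-level k-history t≡pot[k] Ls s∉t λ c c∈k →
                Comparable-sym (ih-t c (∈pot⇒≺ t≡pot[k] (∈⇒∈pot t≡pot[k] c∈k)) Ls
                                     (history-∈⇒level k-history c c∈k))

theorem12 : (V : Set) (_∈_ : V → V → Set) → LEM
    → Extensionality V _∈_ → Separation V _∈_
    → ((F : V → Set) → (∃[ s ] (IsLevel V _∈_ s × F s))
         → ∃[ s ] (IsLevel V _∈_ s × F s × (∀ r → IsLevel V _∈_ r → F r → ¬ (r ∈ s))))
      × (∀ s t → IsLevel V _∈_ s → IsLevel V _∈_ t → (s ∈ t) ⊎ (s ≡ t) ⊎ (t ∈ s))
theorem12 V _∈_ lem ext sep =
  level-∈-minimal V _∈_ sep lem , levels-comparable V _∈_ sep lem ext
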